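{- Let $R$ be a set of permutations. If $R \subseteq S \smallsetminus \mathcal{C}^{\mathrm{inc}}$ or $R \subseteq S \smallsetminus \mathcal{C}^{\mathrm{dec}}$, then $|\mathrm{ASM}_n(R)| \ge \lfloor n/3 \rfloor!$ for all $n$.
   Context: An alternating sign matrix (ASM) is a square matrix with entries in $\{0,1,-1\}$ such that every row and column sums to $1$ and the nonzero entries in each row and column alternate in sign. Permutations are identified with their permutation matrices. $S_n$ is the set of permutations of size $n$ and $S=\bigsqcup_{n\ge 0} S_n$. An ASM $A$ classically contains a permutation $\pi$ of size $k$ if rows and columns of $A$ can be deleted to obtain a $k\times k$ matrix having $1$'s in (at least) all positions where the permutation matrix of $\pi$ has $1$'s; otherwise $A$ classically avoids $\pi$. For a set $R$ of permutations, $\mathrm{ASM}_n(R)$ denotes the set of $n\times n$ ASMs classically avoiding every permutation in $R$. $\mathcal{C}^{\mathrm{inc}}$ (resp. $\mathcal{C}^{\mathrm{dec}}$) is the class of permutations $\pi$ whose permutation matrix has a block form $\begin{pmatrix} 0 & A & 0 \\ B & 0 & C \\ 0 & D & 0 \end{pmatrix}$ in which the entries in each block $A$, $B$, $C$, $D$ form an increasing (resp. decreasing) pattern (i.e. the monotone grid classes $\mathrm{Grid}\left(\begin{smallmatrix}0&1&0\\1&0&1\\0&1&0\end{smallmatrix}\right)$ and $\mathrm{Grid}\left(\begin{smallmatrix}0&-1&0\\-1&0&-1\\0&-1&0\end{smallmatrix}\right)$). -}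

module Defs where

open import Data.Nat as ℕ using (ℕ; zero; suc; _!; _/_)
open import Data.Integer as ℤ using (ℤ; 0ℤ; 1ℤ; -1ℤ; -_)
open import Data.Fin as Fin using (Fin; toℕ)
open import Data.Fin.Permutation using (Permutation′; _⟨$⟩ʳ_)
open import Data.Product using (Σ; _×_; ∃)
open import Data.Sum using (_⊎_)
open import Data.Bool using (true; false)
open import Relation.Binary.PropositionalEquality using (_≡_; _≢_)
open import Relation.Nullary using (¬_)

-- Square integer matrices of size n (row index first).
Matrix : ℕ → Set
Matrix n = Fin n → Fin n → ℤ

ΣFin : ∀ n → (Fin n → ℤ) → ℤ
ΣFin zero    f = 0ℤ
ΣFin (suc n) f = f Fin.zero ℤ.+ ΣFin n (λ i → f (Fin.suc i))

record IsASM {n : ℕ} (A : Matrix n) : Set where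
  field
    entries  : ∀ i j → A i j ≡ 0ℤ ⊎ (A i j ≡ 1ℤ ⊎ A i j ≡ -1ℤ)
    rowSum   : ∀ i → ΣFin n (λ j → A i j) ≡ 1ℤ
    colSum   : ∀ j → ΣFin n (λ i → A i j) ≡ 1ℤ
    rowAlt   : ∀ i j j' → j Fin.< j' → A i j ≢ 0ℤ → A i j' ≢ 0ℤ →
               (∀ l → j Fin.< l → l Fin.< j' → A i l ≡ 0ℤ) →
               A i j' ≡ - A i j
    colAlt   : ∀ j i i' → i Fin.< i' → A i j ≢ 0ℤ → A i' j ≢ 0ℤ →
               (∀ l → i Fin.< l → l Fin.< i' → A l j ≡ 0ℤ) →
               A i' j ≡ - A i j

StrictlyIncreasing : ∀ {k n} → (Fin k → Fin n) → Set
StrictlyIncreasing {k} f = ∀ (i j : Fin k) → i Fin.< j → f i Fin.< f j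

-- The permutation matrix of π has a 1 in position (i , π i).
Contains : ∀ {n k} → Matrix n → Permutation′ k → Set
Contains {n} {k} A π =
  Σ (Fin k → Fin n) λ r → Σ (Fin k → Fin n) λ c →
    StrictlyIncreasing r × StrictlyIncreasing c ×
    (∀ i → A (r i) (c (π ⟨$⟩ʳ i)) ≡ 1ℤ)

PermSet : Set₁
PermSet = (k : ℕ) → Permutation′ k → Set

Avoids : ∀ {n} → PermSet → Matrix n → Set
Avoids {n} R A = ∀ k (π : Permutation′ k) → R k π → ¬ Contains A π

data Part : Set where
  p₀ p₁ p₂ : Part

part : ℕ → ℕ → ℕ → Part
part a b x with x ℕ.<ᵇ a | x ℕ.<ᵇ b
... | true  | _               = p₀
... | false | true  = p₁
... | false | false = p₂

-- Allowed nonzero blocks of the grid matrix (0 1 0 / 1 0 1 / 0 1 0).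
data AllowedBlock : Part → Part → Set where
  blockA : AllowedBlock p₀ p₁
  blockB : AllowedBlock p₁ p₀
  blockC : AllowedBlock p₁ p₂
  blockD : AllowedBlock p₂ p₁

data Orientation : Set where
  inc dec : Orientation

Monotone : Orientation → ℕ → ℕ → Set
Monotone inc x y = x ℕ.< y
Monotone dec x y = y ℕ.< x

InGrid : Orientation → ∀ {k} → Permutation′ k → Set
InGrid o {k} π =
  Σ ℕ λ a → Σ ℕ λ b → Σ ℕ λ c → Σ ℕ λ d →
    a ℕ.≤ b × b ℕ.≤ k × c ℕ.≤ d × d ℕ.≤ k ×
    (∀ i → AllowedBlock (part a b (toℕ i)) (part c d (toℕ (π ⟨$⟩ʳ i)))) ×
    (∀ i j → toℕ i ℕ.< toℕ j →
       part a b (toℕ i) ≡ part a b (toℕ j) →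
       part c d (toℕ (π ⟨$⟩ʳ i)) ≡ part c d (toℕ (π ⟨$⟩ʳ j)) →
       Monotone o (toℕ (π ⟨$⟩ʳ i)) (toℕ (π ⟨$⟩ʳ j)))

Cinc Cdec : ∀ {k} → Permutation′ k → Set
Cinc = InGrid inc
Cdec = InGrid dec

DisjointFrom : PermSet → (∀ {k} → Permutation′ k → Set) → Set
DisjointFrom R C = ∀ k (π : Permutation′ k) → R k π → ¬ C π

-- |ASM_n(R)| ≥ m : there is an injective family of m ASMs avoiding R
-- (matrices compared entrywise).
AtLeast : ℕ → PermSet → ℕ → Set
AtLeast m R n =
  Σ (Fin m → Matrix n) λ f →
    (∀ x → IsASM (f x) × Avoids R (f x)) ×
    (∀ x y → (∀ i j → f x i j ≡ f y i j) → x ≡ y)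

-- Write n = 3m + s with m = ⌊n/3⌋. Every permutation π of size m is placed, negated, in the middle of
-- an n×n ASM whose 1's form the monotone grid pattern (0 1 0 / 1 0 1 / 0 1 0), with identity blocks for
-- Cinc and antidiagonal blocks for Cdec; each row and column then reads 1 or 1, -1, 1. A permutation
-- contained in such a matrix only uses its 1's, so pulling back the cuts of the matrix along the chosen
-- rows and columns exhibits it in the grid class; hence the matrix avoids R. Since π can be read off from
-- the -1's, the m! permutations give m! distinct ASMs.
module Submission where

open import Defs
open import Data.Nat using (ℕ; _!; _/_)
open import Data.Sum using (_⊎_)

open import Function using (_∘_)
open import Data.Nat using (zero; suc; _+_; _∸_; _≤_; _<_; z≤n; s≤s; _<ᵇ_; _≡ᵇ_; _%_; _*_; _≟_; _<?_)
open import Data.Nat.Properties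
open import Data.Nat.DivMod using (m≡m%n+[m/n]*n)
open import Data.Nat.Tactic.RingSolver using (solve-∀)
open import Data.Integer as ℤ using (ℤ; 0ℤ; 1ℤ; -1ℤ; -_) renaming (_+_ to _+ℤ_)
import Data.Integer.Properties as ℤ
open import Algebra.Properties.CommutativeSemigroup ℤ.+-commutativeSemigroup using (interchange)
open import Data.Fin as Fin using (Fin; toℕ; fromℕ<; remQuot; combine; punchIn)
open import Data.Fin.Properties
  using (toℕ-fromℕ<; fromℕ<-toℕ; toℕ-injective; toℕ<n; punchIn-injective; combine-remQuot)
open import Data.Bool as Bool using (true; false; if_then_else_)
open import Data.Unit using (tt)
open import Data.Empty using (⊥-elim)
open import Data.Product using (Σ; _×_; _,_; proj₁; proj₂; uncurry)
open import Data.Sum using (inj₁; inj₂)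
open import Relation.Binary.PropositionalEquality
open import Relation.Binary.Definitions using (tri<; tri≈; tri>)
open import Data.Fin.Permutation using (Permutation′; _⟨$⟩ʳ_; _⟨$⟩ˡ_; inverseˡ; inverseʳ; id; insert)
open import Relation.Nullary using (yes; no; does; proof; ofʸ; ofⁿ)

-1≢0 : -1ℤ ≢ 0ℤ
-1≢0 ()

-1≢1 : -1ℤ ≢ 1ℤ
-1≢1 ()

δ : ℕ → ℕ → ℤ
δ c x = if does (x ≟ c) then 1ℤ else 0ℤ

δ-≡ : ∀ {c x} → x ≡ c → δ c x ≡ 1ℤ
δ-≡ {c} {x} x≡c with x ≡ᵇ c | proof (x ≟ c)
... | true  | _        = refl
... | false | ofⁿ x≢c = ⊥-elim (x≢c x≡c)

δ-≢ : ∀ {c x} → x ≢ c → δ c x ≡ 0ℤ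
δ-≢ {c} {x} x≢c with x ≡ᵇ c | proof (x ≟ c)
... | true  | ofʸ x≡c = ⊥-elim (x≢c x≡c)
... | false | _       = refl

δ-< : ∀ {c x} → x < c → δ c x ≡ 0ℤ
δ-< = δ-≢ ∘ <⇒≢

δ-> : ∀ {c x} → c < x → δ c x ≡ 0ℤ
δ-> = δ-≢ ∘ >⇒≢

δ≢0⇒≡ : ∀ {c x} → δ c x ≢ 0ℤ → x ≡ c
δ≢0⇒≡ {c} {x} δ≢0 with x ≡ᵇ c | proof (x ≟ c)
... | true  | ofʸ x≡c = x≡c
... | false | _       = ⊥-elim (δ≢0 refl)

δ≡1⇒≡ : ∀ {c x} → δ c x ≡ 1ℤ → x ≡ c
δ≡1⇒≡ {c} {x} δ≡1 with x ≡ᵇ c | proof (x ≟ c) | δ≡1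
... | true  | ofʸ x≡c | _ = x≡c
... | false | _       | ()

δ-01 : ∀ c x → δ c x ≡ 0ℤ ⊎ δ c x ≡ 1ℤ
δ-01 c x with x ≡ᵇ c
... | true  = inj₂ refl
... | false = inj₁ refl

-δ≢1 : ∀ c x → - δ c x ≢ 1ℤ
-δ≢1 c x with δ c x | δ-01 c x
... | _ | inj₁ refl = λ ()
... | _ | inj₂ refl = λ ()

δ-cong : ∀ {c x d y} → (x ≡ c → y ≡ d) → (y ≡ d → x ≡ c) → δ c x ≡ δ d y
δ-cong {c} {x} to from with x ≡ᵇ c | proof (x ≟ c)
... | true  | ofʸ x≡c = sym (δ-≡ (to x≡c))
... | false | ofⁿ x≢c = sym (δ-≢ (x≢c ∘ from))

δ-+ : ∀ k {c x} → δ (k + c) (k + x) ≡ δ c x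
δ-+ zero    = refl
δ-+ (suc k) = δ-+ k

δ-swap : ∀ {n} {f g : ℕ → ℕ} → (∀ {u} → u < n → g (f u) ≡ u) → (∀ {u} → u < n → f (g u) ≡ u) →
         ∀ {x y} → x < n → y < n → δ (f x) y ≡ δ (g y) x
δ-swap {f = f} {g} gf fg x<n y<n =
  δ-cong (λ y≡fx → trans (sym (gf x<n)) (cong g (sym y≡fx)))
         (λ x≡gy → trans (sym (fg y<n)) (cong f (sym x≡gy)))

sumN : ℕ → (ℕ → ℤ) → ℤ
sumN zero    f = 0ℤ
sumN (suc n) f = f 0 +ℤ sumN n (f ∘ suc)

ΣFin≡sumN : ∀ n (f : ℕ → ℤ) → ΣFin n (f ∘ toℕ) ≡ sumN n f
ΣFin≡sumN zero    f = refl
ΣFin≡sumN (suc n) f = cong (f 0 +ℤ_) (ΣFin≡sumN n (f ∘ suc))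

sumN-cong : ∀ n {f g : ℕ → ℤ} → (∀ x → x < n → f x ≡ g x) → sumN n f ≡ sumN n g
sumN-cong zero    f≗g = refl
sumN-cong (suc n) f≗g = cong₂ _+ℤ_ (f≗g 0 (s≤s z≤n)) (sumN-cong n (λ x → f≗g (suc x) ∘ s≤s))

sumN-+ : ∀ n (f g : ℕ → ℤ) → sumN n (λ x → f x +ℤ g x) ≡ sumN n f +ℤ sumN n g
sumN-+ zero    f g = refl
sumN-+ (suc n) f g =
  trans (cong (f 0 +ℤ g 0 +ℤ_) (sumN-+ n (f ∘ suc) (g ∘ suc))) (interchange (f 0) (g 0) _ _)

sumN-neg : ∀ n (f : ℕ → ℤ) → sumN n (λ x → - f x) ≡ - sumN n f
sumN-neg zero    f = refl
sumN-neg (suc n) f = trans (cong (- f 0 +ℤ_) (sumN-neg n (f ∘ suc))) (sym (ℤ.neg-distrib-+ (f 0) _))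

sumN-0 : ∀ n → sumN n (λ _ → 0ℤ) ≡ 0ℤ
sumN-0 zero    = refl
sumN-0 (suc n) = cong (0ℤ +ℤ_) (sumN-0 n)

sumN-δ : ∀ {n c} → c < n → sumN n (δ c) ≡ 1ℤ
sumN-δ {suc n} {zero}  _         = cong (1ℤ +ℤ_) (sumN-0 n)
sumN-δ {suc n} {suc c} (s≤s c<n) = cong (0ℤ +ℤ_) (sumN-δ c<n)

tri : ℕ → ℕ → ℕ → ℕ → ℤ
tri a b c x = δ a x +ℤ - δ b x +ℤ δ c x

tri≡δ₁ : ∀ {a b c x} → x ≢ b → x ≢ c → tri a b c x ≡ δ a x
tri≡δ₁ {a} {x = x} x≢b x≢c rewrite δ-≢ x≢b | δ-≢ x≢c =
  trans (ℤ.+-identityʳ _) (ℤ.+-identityʳ (δ a x))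

tri≡-δ₂ : ∀ {a b c x} → x ≢ a → x ≢ c → tri a b c x ≡ - δ b x
tri≡-δ₂ {b = b} {x = x} x≢a x≢c rewrite δ-≢ x≢a | δ-≢ x≢c =
  trans (ℤ.+-identityʳ _) (ℤ.+-identityˡ (- δ b x))

tri≡δ₃ : ∀ {a b c x} → x ≢ a → x ≢ b → tri a b c x ≡ δ c x
tri≡δ₃ x≢a x≢b rewrite δ-≢ x≢a | δ-≢ x≢b = ℤ.+-identityˡ _

tri≢0 : ∀ {a b c} x → tri a b c x ≢ 0ℤ → x ≡ a ⊎ x ≡ b ⊎ x ≡ c
tri≢0 {a} {b} {c} x tri≢0 with x ≟ a | x ≟ b | x ≟ c
... | yes x≡a | _       | _       = inj₁ x≡a
... | no  _   | yes x≡b | _       = inj₂ (inj₁ x≡b)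
... | no  _   | no  _   | yes x≡c = inj₂ (inj₂ x≡c)
... | no  x≢a | no  x≢b | no  x≢c = ⊥-elim (tri≢0 (trans (tri≡δ₃ x≢a x≢b) (δ-≢ x≢c)))

module _ {a b c : ℕ} (a<b : a < b) (b<c : b < c) where

  tri-a : tri a b c a ≡ 1ℤ
  tri-a = trans (tri≡δ₁ (<⇒≢ a<b) (<⇒≢ (<-trans a<b b<c))) (δ-≡ {a} refl)

  tri-b : tri a b c b ≡ -1ℤ
  tri-b = trans (tri≡-δ₂ (>⇒≢ a<b) (<⇒≢ b<c)) (cong -_ (δ-≡ {b} refl))

  tri-c : tri a b c c ≡ 1ℤ
  tri-c = trans (tri≡δ₃ (>⇒≢ (<-trans a<b b<c)) (>⇒≢ b<c)) (δ-≡ {c} refl)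

  tri-entry : ∀ x → tri a b c x ≡ 0ℤ ⊎ (tri a b c x ≡ 1ℤ ⊎ tri a b c x ≡ -1ℤ)
  tri-entry x with tri a b c x ℤ.≟ 0ℤ
  ... | yes tri≡0 = inj₁ tri≡0
  ... | no  tri≢0′ with tri≢0 x tri≢0′
  ...   | inj₁ refl        = inj₂ (inj₁ tri-a)
  ...   | inj₂ (inj₁ refl) = inj₂ (inj₂ tri-b)
  ...   | inj₂ (inj₂ refl) = inj₂ (inj₁ tri-c)

  tri≡-1⇒≡b : ∀ {x} → tri a b c x ≡ -1ℤ → x ≡ b
  tri≡-1⇒≡b {x} tri≡-1 with tri≢0 x (-1≢0 ∘ trans (sym tri≡-1))
  ... | inj₁ refl        = ⊥-elim (-1≢1 (trans (sym tri≡-1) tri-a))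
  ... | inj₂ (inj₁ x≡b)  = x≡b
  ... | inj₂ (inj₂ refl) = ⊥-elim (-1≢1 (trans (sym tri≡-1) tri-c))

  sumN-tri : ∀ {n} → c < n → sumN n (tri a b c) ≡ 1ℤ
  sumN-tri {n} c<n = begin
    sumN n (tri a b c)
      ≡⟨ sumN-+ n _ (δ c) ⟩
    sumN n (λ x → δ a x +ℤ - δ b x) +ℤ sumN n (δ c)
      ≡⟨ cong (_+ℤ sumN n (δ c)) (sumN-+ n (δ a) _) ⟩
    sumN n (δ a) +ℤ sumN n (λ x → - δ b x) +ℤ sumN n (δ c)
      ≡⟨ cong (λ s → sumN n (δ a) +ℤ s +ℤ sumN n (δ c)) (sumN-neg n (δ b)) ⟩
    sumN n (δ a) +ℤ - sumN n (δ b) +ℤ sumN n (δ c)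
      ≡⟨ cong₂ (λ u w → u +ℤ - sumN n (δ b) +ℤ w) (sumN-δ a<n) (sumN-δ c<n) ⟩
    1ℤ +ℤ - sumN n (δ b) +ℤ 1ℤ
      ≡⟨ cong (λ v → 1ℤ +ℤ - v +ℤ 1ℤ) (sumN-δ b<n) ⟩
    1ℤ ∎
    where
    open ≡-Reasoning
    b<n = <-trans b<c c<n
    a<n = <-trans a<b b<n

data SimpleLine (n : ℕ) (f : ℕ → ℤ) : Set where
  pulse  : ∀ {c} → c < n → (∀ x → x < n → f x ≡ δ c x) → SimpleLine n f
  zigzag : ∀ {a b c} → a < b → b < c → c < n → (∀ x → x < n → f x ≡ tri a b c x) → SimpleLine n f

module _ {n : ℕ} {f : ℕ → ℤ} where

  simpleLine-entry : SimpleLine n f → ∀ {x} → x < n → f x ≡ 0ℤ ⊎ (f x ≡ 1ℤ ⊎ f x ≡ -1ℤ)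
  simpleLine-entry (pulse {c} _ f≗δ) {x} x<n rewrite f≗δ x x<n with δ-01 c x
  ... | inj₁ δ≡0 = inj₁ δ≡0
  ... | inj₂ δ≡1 = inj₂ (inj₁ δ≡1)
  simpleLine-entry (zigzag a<b b<c _ f≗tri) {x} x<n rewrite f≗tri x x<n = tri-entry a<b b<c x

  simpleLine-sum : SimpleLine n f → sumN n f ≡ 1ℤ
  simpleLine-sum (pulse c<n f≗δ)           = trans (sumN-cong n f≗δ) (sumN-δ c<n)
  simpleLine-sum (zigzag a<b b<c c<n f≗tri) = trans (sumN-cong n f≗tri) (sumN-tri a<b b<c c<n)

  simpleLine-alternates : SimpleLine n f → ∀ {j j'} → j < j' → j' < n → f j ≢ 0ℤ → f j' ≢ 0ℤ →
                          (∀ l → j < l → l < j' → f l ≡ 0ℤ) → f j' ≡ - f j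
  simpleLine-alternates (pulse _ f≗δ) {j} {j'} j<j' j'<n fj≢0 fj'≢0 _ =
    ⊥-elim (<⇒≢ j<j' (trans (δ≢0⇒≡ (fj≢0 ∘ trans (f≗δ j j<n)))
                            (sym (δ≢0⇒≡ (fj'≢0 ∘ trans (f≗δ j' j'<n))))))
    where j<n = <-trans j<j' j'<n
  simpleLine-alternates (zigzag {a} {b} {c} a<b b<c _ f≗tri) {j} {j'} j<j' j'<n fj≢0 fj'≢0 gap
    with j<n ← <-trans j<j' j'<n
    with tri≢0 j (fj≢0 ∘ trans (f≗tri j j<n)) | tri≢0 j' (fj'≢0 ∘ trans (f≗tri j' j'<n))
  ... | inj₁ refl        | inj₂ (inj₁ refl) =
    trans (f≗tri b j'<n) (trans (tri-b a<b b<c) (cong -_ (sym (trans (f≗tri a j<n) (tri-a a<b b<c)))))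
  ... | inj₂ (inj₁ refl) | inj₂ (inj₂ refl) =
    trans (f≗tri c j'<n) (trans (tri-c a<b b<c) (cong -_ (sym (trans (f≗tri b j<n) (tri-b a<b b<c)))))
  -- the 1 at a and the 1 at c are separated by the -1 at b
  ... | inj₁ refl        | inj₂ (inj₂ refl) =
    ⊥-elim (-1≢0 (trans (sym (tri-b a<b b<c)) (trans (sym (f≗tri b (<-trans b<c j'<n))) (gap b a<b b<c))))
  ... | inj₁ refl        | inj₁ refl        = ⊥-elim (<-irrefl refl j<j')
  ... | inj₂ (inj₁ refl) | inj₂ (inj₁ refl) = ⊥-elim (<-irrefl refl j<j')
  ... | inj₂ (inj₂ refl) | inj₂ (inj₂ refl) = ⊥-elim (<-irrefl refl j<j')
  ... | inj₂ (inj₁ refl) | inj₁ refl        = ⊥-elim (<-asym a<b j<j')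
  ... | inj₂ (inj₂ refl) | inj₁ refl        = ⊥-elim (<-asym (<-trans a<b b<c) j<j')
  ... | inj₂ (inj₂ refl) | inj₂ (inj₁ refl) = ⊥-elim (<-asym b<c j<j')

fin-gap⇒gap : ∀ {N} {P : ℕ → Set} {j j' : Fin N} → (∀ l → j Fin.< l → l Fin.< j' → P (toℕ l)) →
              ∀ l → toℕ j < l → l < toℕ j' → P l
fin-gap⇒gap {P = P} {j' = j'} gap l j<l l<j' =
  subst P (toℕ-fromℕ< l<N) (gap (fromℕ< l<N) (subst (toℕ _ <_) l≡ j<l) (subst (_< toℕ j') l≡ l<j'))
  where l<N = <-trans l<j' (toℕ<n j')
        l≡ = sym (toℕ-fromℕ< l<N)

simpleLines⇒IsASM : ∀ {N} (E : ℕ → ℕ → ℤ) →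
  (∀ i → i < N → SimpleLine N (E i)) → (∀ j → j < N → SimpleLine N (λ i → E i j)) →
  IsASM {N} (λ i j → E (toℕ i) (toℕ j))
simpleLines⇒IsASM {N} E row col = record
  { entries = λ i j → simpleLine-entry (rowᶠ i) (toℕ<n j)
  ; rowSum  = λ i → trans (ΣFin≡sumN N (E (toℕ i))) (simpleLine-sum (rowᶠ i))
  ; colSum  = λ j → trans (ΣFin≡sumN N (λ i → E i (toℕ j))) (simpleLine-sum (colᶠ j))
  ; rowAlt  = λ i j j' j<j' nz nz' gap →
      simpleLine-alternates (rowᶠ i) j<j' (toℕ<n j') nz nz' (fin-gap⇒gap {P = λ l → E (toℕ i) l ≡ 0ℤ} gap)
  ; colAlt  = λ j i i' i<i' nz nz' gap →
      simpleLine-alternates (colᶠ j) i<i' (toℕ<n i') nz nz' (fin-gap⇒gap {P = λ l → E l (toℕ j) ≡ 0ℤ} gap)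
  }
  where
  rowᶠ = λ (i : Fin N) → row (toℕ i) (toℕ<n i)
  colᶠ = λ (j : Fin N) → col (toℕ j) (toℕ<n j)

rank : Part → ℕ
rank p₀ = 0
rank p₁ = 1
rank p₂ = 2

data PartView (a b x : ℕ) : Part → Set where
  below   : x < a → PartView a b x p₀
  between : a ≤ x → x < b → PartView a b x p₁
  above   : a ≤ x → b ≤ x → PartView a b x p₂

partView : ∀ a b x → PartView a b x (part a b x)
partView a b x with x <ᵇ a in x<ᵇa | x <ᵇ b in x<ᵇb
... | true  | _     = below (<ᵇ⇒< x a (subst Bool.T (sym x<ᵇa) tt))
... | false | true  = between (≮⇒≥ (subst Bool.T x<ᵇa ∘ <⇒<ᵇ)) (<ᵇ⇒< x b (subst Bool.T (sym x<ᵇb) tt))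
... | false | false = above (≮⇒≥ (subst Bool.T x<ᵇa ∘ <⇒<ᵇ)) (≮⇒≥ (subst Bool.T x<ᵇb ∘ <⇒<ᵇ))

part-mono : ∀ a b {x y} → x ≤ y → rank (part a b x) ≤ rank (part a b y)
part-mono a b {x} {y} x≤y with part a b x | partView a b x | part a b y | partView a b y
... | p₀ | _            | _  | _            = z≤n
... | p₁ | _            | p₁ | _            = ≤-refl
... | p₁ | _            | p₂ | _            = s≤s z≤n
... | p₂ | _            | p₂ | _            = ≤-refl
... | p₁ | between a≤x _ | p₀ | below y<a    = ⊥-elim (<⇒≱ (≤-<-trans x≤y y<a) a≤x)
... | p₂ | above a≤x _  | p₀ | below y<a    = ⊥-elim (<⇒≱ (≤-<-trans x≤y y<a) a≤x)
... | p₂ | above _ b≤x  | p₁ | between _ y<b = ⊥-elim (<⇒≱ (≤-<-trans x≤y y<b) b≤x)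

part-first : ∀ a b {x} → x < a → part a (a + b) x ≡ p₀
part-first a b {x} x<a with part a (a + b) x | partView a (a + b) x
... | p₀ | _             = refl
... | p₁ | between a≤x _ = ⊥-elim (<⇒≱ x<a a≤x)
... | p₂ | above a≤x _   = ⊥-elim (<⇒≱ x<a a≤x)

part-second : ∀ a b {d} → d < b → part a (a + b) (a + d) ≡ p₁
part-second a b {d} d<b with part a (a + b) (a + d) | partView a (a + b) (a + d)
... | p₀ | below a+d<a  = ⊥-elim (<⇒≱ a+d<a (m≤m+n a d))
... | p₁ | _            = refl
... | p₂ | above _ a+b≤ = ⊥-elim (<⇒≱ (+-monoʳ-< a d<b) a+b≤)

part-third : ∀ a b {d} → part a (a + b) (a + b + d) ≡ p₂
part-third a b {d} with part a (a + b) (a + b + d) | partView a (a + b) (a + b + d)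
... | p₀ | below <a     = ⊥-elim (<⇒≱ <a (≤-trans (m≤m+n a b) (m≤m+n (a + b) d)))
... | p₁ | between _ <b = ⊥-elim (<⇒≱ <b (m≤m+n (a + b) d))
... | p₂ | _            = refl

part-shift : ∀ a b x → part a b x ≢ p₀ → part 0 (suc b) (suc x) ≡ part a b x
part-shift a b x ≢p₀ with x <ᵇ a | x <ᵇ b
... | true  | _     = ⊥-elim (≢p₀ refl)
... | false | true  = refl
... | false | false = refl

p₁≤⇒≢p₀ : ∀ {q} → rank p₁ ≤ rank q → q ≢ p₀
p₁≤⇒≢p₀ () refl

p₂≤⇒≡p₂ : ∀ {q} → rank p₂ ≤ rank q → q ≡ p₂
p₂≤⇒≡p₂ {p₂} _ = refl
p₂≤⇒≡p₂ {p₁} (s≤s ())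

Cuts : ∀ {k} → (Fin k → Part) → Set
Cuts {k} g = Σ ℕ λ a → Σ ℕ λ b → a ≤ b × b ≤ k × (∀ i → part a b (toℕ i) ≡ g i)

monotone⇒cuts : ∀ {k} (g : Fin k → Part) → (∀ i j → toℕ i < toℕ j → rank (g i) ≤ rank (g j)) → Cuts g
monotone⇒cuts {zero}  g _    = 0 , 0 , z≤n , z≤n , λ ()
monotone⇒cuts {suc k} g mono
  with monotone⇒cuts (g ∘ Fin.suc) (λ i j → mono (Fin.suc i) (Fin.suc j) ∘ s≤s)
     | g Fin.zero in g0 | (λ i → mono Fin.zero (Fin.suc i) (s≤s z≤n))
... | a , b , a≤b , b≤k , cuts | p₀ | _ =
  suc a , suc b , s≤s a≤b , s≤s b≤k , λ { Fin.zero → sym g0 ; (Fin.suc i) → cuts i }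
... | a , b , _ , b≤k , cuts | p₁ | head≤ =
  0 , suc b , z≤n , s≤s b≤k , λ
    { Fin.zero    → sym g0
    ; (Fin.suc i) → trans (part-shift a b (toℕ i) (subst (_≢ p₀) (sym (cuts i)) (p₁≤⇒≢p₀ (head≤ i)))) (cuts i)
    }
... | _ | p₂ | head≤ =
  0 , 0 , z≤n , z≤n , λ { Fin.zero → sym g0 ; (Fin.suc i) → sym (p₂≤⇒≡p₂ (head≤ i)) }

strictlyIncreasing-reflects-< : ∀ {k n} {f : Fin k → Fin n} → StrictlyIncreasing f →
                                ∀ {u v} → toℕ (f u) < toℕ (f v) → toℕ u < toℕ v
strictlyIncreasing-reflects-< {f = f} f↑ {u} {v} fu<fv with <-cmp (toℕ u) (toℕ v)
... | tri< u<v _ _ = u<v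
... | tri≈ _ u≡v _ = ⊥-elim (<-irrefl (cong (toℕ ∘ f) (toℕ-injective u≡v)) fu<fv)
... | tri> _ _ v<u = ⊥-elim (<-asym fu<fv (f↑ v u v<u))

strictlyIncreasing-reflects-Monotone : ∀ o {k n} {f : Fin k → Fin n} → StrictlyIncreasing f →
  ∀ {u v} → Monotone o (toℕ (f u)) (toℕ (f v)) → Monotone o (toℕ u) (toℕ v)
strictlyIncreasing-reflects-Monotone inc f↑ = strictlyIncreasing-reflects-< f↑
strictlyIncreasing-reflects-Monotone dec f↑ = strictlyIncreasing-reflects-< f↑

record Gridded (o : Orientation) {N : ℕ} (M : Matrix N) : Set where
  field
    r₁ r₂ c₁ c₂ : ℕ
    ones-allowed  : ∀ {i j} → M i j ≡ 1ℤ → AllowedBlock (part r₁ r₂ (toℕ i)) (part c₁ c₂ (toℕ j))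
    ones-monotone : ∀ {i i' j j'} → toℕ i < toℕ i' → M i j ≡ 1ℤ → M i' j' ≡ 1ℤ →
                    part r₁ r₂ (toℕ i) ≡ part r₁ r₂ (toℕ i') → part c₁ c₂ (toℕ j) ≡ part c₁ c₂ (toℕ j') →
                    Monotone o (toℕ j) (toℕ j')

module _ {o N} {M : Matrix N} (G : Gridded o M) where
  open Gridded G

  -- The cuts of the pattern are the preimages of the cuts of the matrix.
  gridded-contains⇒InGrid : ∀ {k} {ρ : Permutation′ k} → Contains M ρ → InGrid o ρ
  gridded-contains⇒InGrid {k} {ρ} (r , c , r↑ , c↑ , ones)
    with monotone⇒cuts (λ i → part r₁ r₂ (toℕ (r i))) (λ i j → part-mono r₁ r₂ ∘ <⇒≤ ∘ r↑ i j)
       | monotone⇒cuts (λ j → part c₁ c₂ (toℕ (c j))) (λ i j → part-mono c₁ c₂ ∘ <⇒≤ ∘ c↑ i j)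
  ... | a , b , a≤b , b≤k , rowCuts | c′ , d , c≤d , d≤k , colCuts =
    a , b , c′ , d , a≤b , b≤k , c≤d , d≤k , allowed , monotone
    where
    allowed : ∀ i → AllowedBlock (part a b (toℕ i)) (part c′ d (toℕ (ρ ⟨$⟩ʳ i)))
    allowed i = subst₂ AllowedBlock (sym (rowCuts i)) (sym (colCuts (ρ ⟨$⟩ʳ i))) (ones-allowed (ones i))
    monotone : ∀ i j → toℕ i < toℕ j → part a b (toℕ i) ≡ part a b (toℕ j) →
               part c′ d (toℕ (ρ ⟨$⟩ʳ i)) ≡ part c′ d (toℕ (ρ ⟨$⟩ʳ j)) →
               Monotone o (toℕ (ρ ⟨$⟩ʳ i)) (toℕ (ρ ⟨$⟩ʳ j))
    monotone i j i<j same-row same-col = strictlyIncreasing-reflects-Monotone o c↑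
      (ones-monotone (r↑ i j i<j) (ones i) (ones j)
        (trans (sym (rowCuts i)) (trans same-row (rowCuts j)))
        (trans (sym (colCuts _)) (trans same-col (colCuts _))))

  gridded⇒avoids : ∀ {R} → DisjointFrom R (InGrid o) → Avoids R M
  gridded⇒avoids R∩grid=∅ k ρ ρ∈R = R∩grid=∅ k ρ ρ∈R ∘ gridded-contains⇒InGrid {ρ = ρ}

data Split (a b : ℕ) : ℕ → Set where
  first  : ∀ {x} → x < a → Split a b x
  second : ∀ {d} → d < b → Split a b (a + d)
  third  : ∀ d → Split a b (a + b + d)

split : ∀ a b x → Split a b x
split a b x with x <? a
... | yes x<a = first x<a
... | no  x≮a with x ∸ a <? b
...   | yes x∸a<b = subst (Split a b) (m+[n∸m]≡n (≮⇒≥ x≮a)) (second x∸a<b)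
...   | no  x∸a≮b = subst (Split a b) a+b+[x∸a∸b]≡x (third (x ∸ a ∸ b))
  where
  a+b+[x∸a∸b]≡x : a + b + (x ∸ a ∸ b) ≡ x
  a+b+[x∸a∸b]≡x = trans (+-assoc a b _) (trans (cong (a +_) (m+[n∸m]≡n (≮⇒≥ x∸a≮b))) (m+[n∸m]≡n (≮⇒≥ x≮a)))

-- The position of the k-th point of a monotone block of size sz: the identity or the antidiagonal.
orient : Orientation → ℕ → ℕ → ℕ
orient inc sz k = k
orient dec sz k = sz ∸ suc k

orient-< : ∀ o {sz k} → k < sz → orient o sz k < sz
orient-< inc       k<sz = k<sz
orient-< dec {suc sz} {k} _ = s≤s (m∸n≤m sz k)

orient-involutive : ∀ o {sz k} → k < sz → orient o sz (orient o sz k) ≡ k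
orient-involutive inc _ = refl
orient-involutive dec {suc sz} (s≤s k≤sz) = m∸[m∸n]≡n k≤sz

orient-monotone : ∀ o {sz u v} → u < v → v < sz → Monotone o (orient o sz u) (orient o sz v)
orient-monotone inc u<v _ = u<v
orient-monotone dec {suc sz} u<v (s≤s v≤sz) = ∸-monoʳ-< u<v v≤sz

δ-orient-swap : ∀ o {sz u v} → u < sz → v < sz → δ (orient o sz u) v ≡ δ (orient o sz v) u
δ-orient-swap o {sz} = δ-swap {f = orient o sz} {orient o sz} (orient-involutive o) (orient-involutive o)

Monotone-cancel-∸ : ∀ o {a u v} → a ≤ u → a ≤ v → Monotone o (u ∸ a) (v ∸ a) → Monotone o u v
Monotone-cancel-∸ inc {a} a≤u a≤v u∸a<v∸a = subst₂ _<_ (m+[n∸m]≡n a≤u) (m+[n∸m]≡n a≤v) (+-monoʳ-< a u∸a<v∸a)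
Monotone-cancel-∸ dec {a} a≤u a≤v v∸a<u∸a = subst₂ _<_ (m+[n∸m]≡n a≤v) (m+[n∸m]≡n a≤u) (+-monoʳ-< a v∸a<u∸a)

-- Junk value 0 outside [0, m).
onℕ : ∀ {m} → (Fin m → Fin m) → ℕ → ℕ
onℕ {m} f k with k <? m
... | yes k<m = toℕ (f (fromℕ< k<m))
... | no  _   = 0

onℕ-toℕ : ∀ {m} (f : Fin m → Fin m) i → onℕ f (toℕ i) ≡ toℕ (f i)
onℕ-toℕ {m} f i with toℕ i <? m
... | yes i<m = cong (toℕ ∘ f) (fromℕ<-toℕ i i<m)
... | no  i≮m = ⊥-elim (i≮m (toℕ<n i))

onℕ-fromℕ< : ∀ {m} (f : Fin m → Fin m) {k} (k<m : k < m) → onℕ f k ≡ toℕ (f (fromℕ< k<m))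
onℕ-fromℕ< f {k} k<m = trans (cong (onℕ f) (sym (toℕ-fromℕ< k<m))) (onℕ-toℕ f (fromℕ< k<m))

onℕ-< : ∀ {m} (f : Fin m → Fin m) {k} → k < m → onℕ f k < m
onℕ-< f k<m = subst (_< _) (sym (onℕ-fromℕ< f k<m)) (toℕ<n _)

onℕ-inverse : ∀ {m} {f g : Fin m → Fin m} → (∀ {i} → g (f i) ≡ i) → ∀ {k} → k < m → onℕ g (onℕ f k) ≡ k
onℕ-inverse {f = f} {g} g∘f {k} k<m = begin
  onℕ g (onℕ f k)                   ≡⟨ cong (onℕ g) (onℕ-fromℕ< f k<m) ⟩
  onℕ g (toℕ (f (fromℕ< k<m)))      ≡⟨ onℕ-toℕ g _ ⟩
  toℕ (g (f (fromℕ< k<m)))          ≡⟨ cong toℕ g∘f ⟩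
  toℕ (fromℕ< k<m)                  ≡⟨ toℕ-fromℕ< k<m ⟩
  k                                 ∎
  where open ≡-Reasoning

-- With T = m + s and J the identity (o = inc) or antidiagonal (o = dec) matrix of size m (or T), the matrix
--
--          m       T          m
--     T  [ 0      J_T         0 ]
--     m  [ J     -π | 0       J ]
--     m  [ 0      J | 0       0 ]
--
-- is an ASM (each row and column is a single 1 or reads 1, -1, 1), its 1's lie in the four blocks of
-- the grid class and are monotone there, and its -1's are exactly the matrix of π.
module Construction (o : Orientation) (m s : ℕ) (π : Permutation′ m) where

  T N : ℕ
  T = m + s
  N = T + m + m

  m≤T : m ≤ T
  m≤T = m≤m+n m s

  m+T+m≡N : m + T + m ≡ N
  m+T+m≡N = cong (_+ m) (+-comm m T)

  m+T≤N : m + T ≤ N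
  m+T≤N = subst (m + T ≤_) m+T+m≡N (m≤m+n (m + T) m)

  σ σ⁻¹ : ℕ → ℕ
  σ   = onℕ (π ⟨$⟩ʳ_)
  σ⁻¹ = onℕ (π ⟨$⟩ˡ_)

  δ-σ-swap : ∀ {d y} → d < m → y < m → δ (σ d) y ≡ δ (σ⁻¹ y) d
  δ-σ-swap = δ-swap {f = σ} {σ⁻¹} (onℕ-inverse (inverseˡ π)) (onℕ-inverse (inverseʳ π))

  rowPart colPart : ℕ → Part
  rowPart = part T (T + m)
  colPart = part m (m + T)

  rowPart-top : ∀ {i} → i < T → rowPart i ≡ p₀
  rowPart-top = part-first T m
  rowPart-middle : ∀ {d} → d < m → rowPart (T + d) ≡ p₁
  rowPart-middle = part-second T m
  rowPart-bottom : ∀ {d} → rowPart (T + m + d) ≡ p₂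
  rowPart-bottom = part-third T m
  colPart-left : ∀ {j} → j < m → colPart j ≡ p₀
  colPart-left = part-first m T
  colPart-middle : ∀ {e} → e < T → colPart (m + e) ≡ p₁
  colPart-middle = part-second m T
  colPart-right : ∀ {e} → colPart (m + T + e) ≡ p₂
  colPart-right = part-third m T

  rowOffset colOffset rowSize : Part → ℕ
  rowOffset p₀ = 0
  rowOffset p₁ = T
  rowOffset p₂ = T + m
  colOffset p₀ = 0
  colOffset p₁ = m
  colOffset p₂ = m + T
  rowSize p₀ = T
  rowSize p₁ = m
  rowSize p₂ = m

  -- entries of a block, in coordinates relative to the block
  block : Part → Part → ℕ → ℕ → ℤ
  block p₁ p₁ u v = - δ (σ u) v
  block p₀ p₁ u v = δ (orient o T u) v
  block p₁ p₀ u v = δ (orient o m u) v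
  block p₁ p₂ u v = δ (orient o m u) v
  block p₂ p₁ u v = δ (orient o m u) v
  block _  _  _ _ = 0ℤ

  E : ℕ → ℕ → ℤ
  E i j = block (rowPart i) (colPart j) (i ∸ rowOffset (rowPart i)) (j ∸ colOffset (colPart j))

  M : Matrix N
  M i j = E (toℕ i) (toℕ j)

  E-at : ∀ p q {u v} → rowPart (rowOffset p + u) ≡ p → colPart (colOffset q + v) ≡ q →
         E (rowOffset p + u) (colOffset q + v) ≡ block p q u v
  E-at p q {u} {v} row≡p col≡q rewrite row≡p | col≡q =
    cong₂ (block p q) (m+n∸m≡n (rowOffset p) u) (m+n∸m≡n (colOffset q) v)

  E-top-row : ∀ {i} → i < T → ∀ x → E i x ≡ δ (m + orient o T i) x
  E-top-row {i} i<T x with split m T x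
  ... | first x<m = trans (E-at p₀ p₀ (rowPart-top i<T) (colPart-left x<m)) (sym (δ-< (m≤n⇒m≤n+o _ x<m)))
  ... | second e<T = trans (E-at p₀ p₁ (rowPart-top i<T) (colPart-middle e<T)) (sym (δ-+ m))
  ... | third e = trans (E-at p₀ p₂ (rowPart-top i<T) colPart-right)
                        (sym (δ-> (m≤n⇒m≤n+o e (+-monoʳ-< m (orient-< o i<T)))))

  module _ {d : ℕ} (d<m : d < m) where

    middleRow-a<b : orient o m d < m + σ d
    middleRow-a<b = m≤n⇒m≤n+o _ (orient-< o d<m)

    middleRow-b<c : m + σ d < m + T + orient o m d
    middleRow-b<c = m≤n⇒m≤n+o _ (+-monoʳ-< m (<-≤-trans (onℕ-< _ d<m) m≤T))

    middleRow-c<N : m + T + orient o m d < N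
    middleRow-c<N = subst (m + T + orient o m d <_) m+T+m≡N (+-monoʳ-< (m + T) (orient-< o d<m))

    E-middle-row : ∀ x → E (T + d) x ≡ tri (orient o m d) (m + σ d) (m + T + orient o m d) x
    E-middle-row x with split m T x
    ... | first x<m = trans (E-at p₁ p₀ (rowPart-middle d<m) (colPart-left x<m))
      (sym (tri≡δ₁ (<⇒≢ (m≤n⇒m≤n+o _ x<m)) (<⇒≢ (m≤n⇒m≤n+o _ (m≤n⇒m≤n+o T x<m)))))
    ... | second {e} e<T = trans (E-at p₁ p₁ (rowPart-middle d<m) (colPart-middle e<T))
      (trans (cong -_ (sym (δ-+ m)))
             (sym (tri≡-δ₂ (>⇒≢ (m≤n⇒m≤n+o e (orient-< o d<m))) (<⇒≢ (m≤n⇒m≤n+o _ (+-monoʳ-< m e<T))))))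
    ... | third e = trans (E-at p₁ p₂ (rowPart-middle d<m) colPart-right)
      (trans (sym (δ-+ (m + T)))
             (sym (tri≡δ₃ (>⇒≢ (m≤n⇒m≤n+o e (m≤n⇒m≤n+o T (orient-< o d<m))))
                          (>⇒≢ (m≤n⇒m≤n+o e (+-monoʳ-< m (<-≤-trans (onℕ-< _ d<m) m≤T)))))))

    E-bottom-row : ∀ x → E (T + m + d) x ≡ δ (m + orient o m d) x
    E-bottom-row x with split m T x
    ... | first x<m = trans (E-at p₂ p₀ rowPart-bottom (colPart-left x<m)) (sym (δ-< (m≤n⇒m≤n+o _ x<m)))
    ... | second e<T = trans (E-at p₂ p₁ rowPart-bottom (colPart-middle e<T)) (sym (δ-+ m))
    ... | third e = trans (E-at p₂ p₂ rowPart-bottom colPart-right)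
      (sym (δ-> (m≤n⇒m≤n+o e (+-monoʳ-< m (<-≤-trans (orient-< o d<m) m≤T)))))

  module _ {y : ℕ} (y<m : y < m) where

    private
      y<T : y < T
      y<T = <-≤-trans y<m m≤T

    E-left-col : ∀ i → E i y ≡ δ (T + orient o m y) i
    E-left-col i with split T m i
    ... | first i<T = trans (E-at p₀ p₀ (rowPart-top i<T) (colPart-left y<m)) (sym (δ-< (m≤n⇒m≤n+o _ i<T)))
    ... | second d<m = trans (E-at p₁ p₀ (rowPart-middle d<m) (colPart-left y<m))
                             (trans (δ-orient-swap o d<m y<m) (sym (δ-+ T)))
    ... | third d = trans (E-at p₂ p₀ rowPart-bottom (colPart-left y<m))
                          (sym (δ-> (m≤n⇒m≤n+o d (+-monoʳ-< T (orient-< o y<m)))))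

    E-middle-col : ∀ i → i < N → E i (m + y) ≡ tri (orient o T y) (T + σ⁻¹ y) (T + m + orient o m y) i
    E-middle-col i i<N with split T m i
    ... | first i<T = trans (E-at p₀ p₁ (rowPart-top i<T) (colPart-middle y<T))
      (trans (δ-orient-swap o i<T y<T)
             (sym (tri≡δ₁ (<⇒≢ (m≤n⇒m≤n+o _ i<T)) (<⇒≢ (m≤n⇒m≤n+o _ (m≤n⇒m≤n+o m i<T))))))
    ... | second {d} d<m = trans (E-at p₁ p₁ (rowPart-middle d<m) (colPart-middle y<T))
      (trans (cong -_ (trans (δ-σ-swap d<m y<m) (sym (δ-+ T))))
             (sym (tri≡-δ₂ (>⇒≢ (m≤n⇒m≤n+o d (orient-< o y<T)))
                           (<⇒≢ (m≤n⇒m≤n+o _ (+-monoʳ-< T d<m))))))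
    ... | third d = trans (E-at p₂ p₁ rowPart-bottom (colPart-middle y<T))
      (trans (δ-orient-swap o d<m y<m)
      (trans (sym (δ-+ (T + m)))
             (sym (tri≡δ₃ (>⇒≢ (m≤n⇒m≤n+o d (m≤n⇒m≤n+o m (orient-< o y<T))))
                          (>⇒≢ (m≤n⇒m≤n+o d (+-monoʳ-< T (onℕ-< _ y<m))))))))
      where d<m = +-cancelˡ-< (T + m) d m i<N

    E-right-col : ∀ i → E i (m + T + y) ≡ δ (T + orient o m y) i
    E-right-col i with split T m i
    ... | first i<T = trans (E-at p₀ p₂ (rowPart-top i<T) colPart-right) (sym (δ-< (m≤n⇒m≤n+o _ i<T)))
    ... | second d<m = trans (E-at p₁ p₂ (rowPart-middle d<m) colPart-right)
                             (trans (δ-orient-swap o d<m y<m) (sym (δ-+ T)))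
    ... | third d = trans (E-at p₂ p₂ rowPart-bottom colPart-right)
                          (sym (δ-> (m≤n⇒m≤n+o d (+-monoʳ-< T (orient-< o y<m)))))

    T+orient<N : T + orient o m y < N
    T+orient<N = m≤n⇒m≤n+o m (+-monoʳ-< T (orient-< o y<m))

    middleCol-b<c : T + σ⁻¹ y < T + m + orient o m y
    middleCol-b<c = m≤n⇒m≤n+o _ (+-monoʳ-< T (onℕ-< _ y<m))

  E-padding-col : ∀ {y} → m ≤ y → y < T → ∀ i → i < N → E i (m + y) ≡ δ (orient o T y) i
  E-padding-col {y} m≤y y<T i i<N with split T m i
  ... | first i<T = trans (E-at p₀ p₁ (rowPart-top i<T) (colPart-middle y<T)) (δ-orient-swap o i<T y<T)
  ... | second {d} d<m = trans (E-at p₁ p₁ (rowPart-middle d<m) (colPart-middle y<T))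
    (trans (cong -_ (δ-> (<-≤-trans (onℕ-< _ d<m) m≤y))) (sym (δ-> (m≤n⇒m≤n+o d (orient-< o y<T)))))
  ... | third d = trans (E-at p₂ p₁ rowPart-bottom (colPart-middle y<T))
    (trans (δ-> (<-≤-trans (orient-< o (+-cancelˡ-< (T + m) d m i<N)) m≤y))
           (sym (δ-> (m≤n⇒m≤n+o d (m≤n⇒m≤n+o m (orient-< o y<T))))))

  row-simple : ∀ i → i < N → SimpleLine N (E i)
  row-simple i i<N with split T m i
  ... | first i<T = pulse (<-≤-trans (+-monoʳ-< m (orient-< o i<T)) m+T≤N) (λ x _ → E-top-row i<T x)
  ... | second d<m =
    zigzag (middleRow-a<b d<m) (middleRow-b<c d<m) (middleRow-c<N d<m) (λ x _ → E-middle-row d<m x)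
  ... | third d = pulse (<-≤-trans (+-monoʳ-< m (<-≤-trans (orient-< o d<m) m≤T)) m+T≤N)
                        (λ x _ → E-bottom-row d<m x)
    where d<m = +-cancelˡ-< (T + m) d m i<N

  col-simple : ∀ j → j < N → SimpleLine N (λ i → E i j)
  col-simple j j<N with split m T j
  ... | first j<m = pulse (T+orient<N j<m) (λ i _ → E-left-col j<m i)
  ... | second {y} y<T with y <? m
  ...   | yes y<m = zigzag (m≤n⇒m≤n+o _ (orient-< o y<T)) (middleCol-b<c y<m)
                             (+-monoʳ-< (T + m) (orient-< o y<m)) (E-middle-col y<m)
  ...   | no  y≮m = pulse (m≤n⇒m≤n+o m (m≤n⇒m≤n+o m (orient-< o y<T))) (E-padding-col (≮⇒≥ y≮m) y<T)
  col-simple j j<N | third y = pulse (T+orient<N y<m) (λ i _ → E-right-col y<m i)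
    where y<m = +-cancelˡ-< (m + T) y m (subst (m + T + y <_) (sym m+T+m≡N) j<N)

  isASM : IsASM M
  isASM = simpleLines⇒IsASM E row-simple col-simple

  block-one : ∀ p q {u v} → block p q u v ≡ 1ℤ → AllowedBlock p q × v ≡ orient o (rowSize p) u
  block-one p₀ p₁ one = blockA , δ≡1⇒≡ one
  block-one p₁ p₀ one = blockB , δ≡1⇒≡ one
  block-one p₁ p₂ one = blockC , δ≡1⇒≡ one
  block-one p₂ p₁ one = blockD , δ≡1⇒≡ one
  block-one p₁ p₁ {u} {v} one = ⊥-elim (-δ≢1 (σ u) v one)
  block-one p₀ p₀ ()
  block-one p₀ p₂ ()
  block-one p₂ p₀ ()
  block-one p₂ p₂ ()

  rowPart-bounds : ∀ {i p} → rowPart i ≡ p → i < N → rowOffset p ≤ i × i ∸ rowOffset p < rowSize p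
  rowPart-bounds {i} refl i<N with split T m i
  ... | first i<T rewrite rowPart-top i<T = z≤n , i<T
  ... | second {d} d<m rewrite rowPart-middle d<m = m≤m+n T d , subst (_< m) (sym (m+n∸m≡n T d)) d<m
  ... | third d rewrite rowPart-bottom {d} =
    m≤m+n (T + m) d , subst (_< m) (sym (m+n∸m≡n (T + m) d)) (+-cancelˡ-< (T + m) d m i<N)

  colPart-offset : ∀ {j q} → colPart j ≡ q → colOffset q ≤ j
  colPart-offset {j} refl with split m T j
  ... | first j<m rewrite colPart-left j<m = z≤n
  ... | second {e} e<T rewrite colPart-middle e<T = m≤m+n m e
  ... | third e rewrite colPart-right {e} = m≤m+n (m + T) e

  -- Within a block the 1's lie on the graph of orient, shifted by the block's offsets.
  ones-monotone : ∀ {i i' j j'} → i < i' → i' < N → E i j ≡ 1ℤ → E i' j' ≡ 1ℤ →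
                  rowPart i ≡ rowPart i' → colPart j ≡ colPart j' → Monotone o j j'
  ones-monotone {i} {i'} {j} {j'} i<i' i'<N one one' same-row same-col =
    Monotone-cancel-∸ o (colPart-offset same-col) (colPart-offset refl)
      (subst₂ (Monotone o) (sym j-position) (sym j'-position) (orient-monotone o u<u' u'<size))
    where
    p = rowPart i'
    q = colPart j'
    j-position : j ∸ colOffset q ≡ orient o (rowSize p) (i ∸ rowOffset p)
    j-position = proj₂ (block-one p q
      (subst₂ (λ p q → block p q (i ∸ rowOffset p) (j ∸ colOffset q) ≡ 1ℤ) same-row same-col one))
    j'-position : j' ∸ colOffset q ≡ orient o (rowSize p) (i' ∸ rowOffset p)
    j'-position = proj₂ (block-one p q one')
    u<u' : i ∸ rowOffset p < i' ∸ rowOffset p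
    u<u' = ∸-monoˡ-< i<i' (proj₁ (rowPart-bounds same-row (<-trans i<i' i'<N)))
    u'<size : i' ∸ rowOffset p < rowSize p
    u'<size = proj₂ (rowPart-bounds refl i'<N)

  gridded : Gridded o M
  gridded = record
    { r₁ = T ; r₂ = T + m ; c₁ = m ; c₂ = m + T
    ; ones-allowed  = λ {i} {j} → proj₁ ∘ block-one (rowPart (toℕ i)) (colPart (toℕ j))
    ; ones-monotone = λ {_} {i'} i<i' → ones-monotone i<i' (toℕ<n i')
    }

  minusOne-at : ∀ {d} → d < m → E (T + d) (m + σ d) ≡ -1ℤ
  minusOne-at d<m = trans (E-middle-row d<m _) (tri-b (middleRow-a<b d<m) (middleRow-b<c d<m))

  minusOne⇒position : ∀ {d x} → d < m → E (T + d) x ≡ -1ℤ → x ≡ m + σ d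
  minusOne⇒position d<m E≡-1 =
    tri≡-1⇒≡b (middleRow-a<b d<m) (middleRow-b<c d<m) (trans (sym (E-middle-row d<m _)) E≡-1)

construction-injective : ∀ o m s {π ρ : Permutation′ m} →
  (∀ i j → Construction.M o m s π i j ≡ Construction.M o m s ρ i j) → ∀ k → π ⟨$⟩ʳ k ≡ ρ ⟨$⟩ʳ k
construction-injective o m s {π} {ρ} Mπ≡Mρ k = toℕ-injective (begin
  toℕ (π ⟨$⟩ʳ k)  ≡⟨ sym (onℕ-toℕ (π ⟨$⟩ʳ_) k) ⟩
  P.σ (toℕ k)     ≡⟨ +-cancelˡ-≡ m _ _ (R.minusOne⇒position k<m R-minusOne) ⟩
  R.σ (toℕ k)     ≡⟨ onℕ-toℕ (ρ ⟨$⟩ʳ_) k ⟩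
  toℕ (ρ ⟨$⟩ʳ k)  ∎)
  where
  open ≡-Reasoning
  module P = Construction o m s π
  module R = Construction o m s ρ
  k<m = toℕ<n k
  Eπ≡Eρ : ∀ {i j} → i < P.N → j < P.N → P.E i j ≡ R.E i j
  Eπ≡Eρ i<N j<N = subst₂ (λ i j → P.E i j ≡ R.E i j) (toℕ-fromℕ< i<N) (toℕ-fromℕ< j<N) (Mπ≡Mρ _ _)
  R-minusOne : R.E (P.T + toℕ k) (m + P.σ (toℕ k)) ≡ -1ℤ
  R-minusOne = trans (sym (Eπ≡Eρ (m≤n⇒m≤n+o m (+-monoʳ-< P.T k<m))
                                 (<-≤-trans (+-monoʳ-< m (<-≤-trans (onℕ-< _ k<m) P.m≤T)) P.m+T≤N)))
                     (P.minusOne-at k<m)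

nthPermutation : ∀ m → Fin (m !) → Permutation′ m
nthPermutation zero    _ = id
nthPermutation (suc m) x =
  insert Fin.zero (proj₁ (remQuot {suc m} (m !) x)) (nthPermutation m (proj₂ (remQuot {suc m} (m !) x)))

nthPermutation-injective : ∀ m {x y} → (∀ k → nthPermutation m x ⟨$⟩ʳ k ≡ nthPermutation m y ⟨$⟩ʳ k) → x ≡ y
nthPermutation-injective zero    {Fin.zero} {Fin.zero} _ = refl
nthPermutation-injective (suc m) {x} {y} πx≈πy = begin
  x                                          ≡⟨ sym (combine-remQuot {suc m} (m !) x) ⟩
  uncurry combine (remQuot {suc m} (m !) x)  ≡⟨ cong (uncurry combine) (cong₂ _,_ head≡ tail≡) ⟩
  uncurry combine (remQuot {suc m} (m !) y)  ≡⟨ combine-remQuot {suc m} (m !) y ⟩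
  y                                          ∎
  where
  open ≡-Reasoning
  head≡ : proj₁ (remQuot {suc m} (m !) x) ≡ proj₁ (remQuot {suc m} (m !) y)
  head≡ = πx≈πy Fin.zero
  tail≡ : proj₂ (remQuot {suc m} (m !) x) ≡ proj₂ (remQuot {suc m} (m !) y)
  tail≡ = nthPermutation-injective m λ k →
    punchIn-injective _ _ _ (trans (πx≈πy (Fin.suc k)) (cong (λ h → punchIn h _) (sym head≡)))

asmFamily : ∀ o {R} → DisjointFrom R (InGrid o) → ∀ m s → AtLeast (m !) R (m + s + m + m)
asmFamily o R∩grid=∅ m s =
  (λ x → Construction.M o m s (nthPermutation m x)) ,
  (λ x → Construction.isASM o m s (nthPermutation m x) ,
         gridded⇒avoids (Construction.gridded o m s (nthPermutation m x)) R∩grid=∅) ,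
  (λ x y Mx≡My → nthPermutation-injective m (construction-injective o m s Mx≡My))

q+r+q+q≡r+q*3 : ∀ q r → q + r + q + q ≡ r + q * 3
q+r+q+q≡r+q*3 = solve-∀

theorem3p1 : (R : PermSet) → DisjointFrom R Cinc ⊎ DisjointFrom R Cdec →
    ∀ (n : ℕ) → AtLeast ((n / 3) !) R n
theorem3p1 R R∩C=∅ n = subst (AtLeast ((n / 3) !) R) n≡ (family R∩C=∅)
  where
  n≡ : n / 3 + n % 3 + n / 3 + n / 3 ≡ n
  n≡ = trans (q+r+q+q≡r+q*3 (n / 3) (n % 3)) (sym (m≡m%n+[m/n]*n n 3))
  family : DisjointFrom R Cinc ⊎ DisjointFrom R Cdec → AtLeast ((n / 3) !) R (n / 3 + n % 3 + n / 3 + n / 3)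
  family (inj₁ R∩Cinc=∅) = asmFamily inc R∩Cinc=∅ (n / 3) (n % 3)
  family (inj₂ R∩Cdec=∅) = asmFamily dec R∩Cdec=∅ (n / 3) (n % 3)
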